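{- Let $T^\star$ be a maximal consistent set of $LCL$-formulas, let $\mathcal M_{T^\star}=\langle D,\{A^\sigma\}_\sigma,\cdot,\mathbf s,\mathbf k,\mathbf i\rangle$ with $D=\{[M]\mid M\in CL\}$, $A^\sigma=\{[M]\mid M\in CL\text{ and }M:\sigma\in T^\star\}$, $[M]\cdot[N]=[MN]$, $\mathbf s=[\mathsf S]$, $\mathbf k=[\mathsf K]$, $\mathbf i=[\mathsf I]$, and let $\rho^\star$ be the environment $\rho^\star(x)=[x]$. Then for every $LCL$-formula $\alpha$: $\langle\mathcal M_{T^\star},\rho^\star\rangle\models\alpha$ if and only if $\alpha\in T^\star$.
   Context: $CL$ is the set of terms $M,N ::= x \mid \mathsf{S} \mid \mathsf{K} \mid \mathsf{I} \mid MN$ over a countable set $V$ of term variables. The equational theory $\mathcal{EQ}^\eta$ has axioms $M=M$, $\mathsf S MNL=(ML)(NL)$, $\mathsf K MN=M$, $\mathsf I M=M$ and rules of symmetry, transitivity, $M=N\Rightarrow MP=NP$, $M=N\Rightarrow PM=PN$, and extensionality (from $Mx=Nx$ with $x$ not occurring in $M,N$ infer $M=N$); $M=_{w,\eta}N$ means $M=N$ is provable in it, and $[M]$ is the equivalence class of $M$. Simple types $\sigma ::= a\mid\sigma\to\tau$. $CL_\rightarrow$ is the set of statements $M:\sigma$ derivable from some basis (set of declarations $x:\sigma$ with distinct variables) in simply typed combinatory logic (rules: $x:\sigma$ if declared; $\mathsf S:(\sigma\to(\rho\to\tau))\to((\sigma\to\rho)\to(\sigma\to\tau))$; $\mathsf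 K:\sigma\to(\tau\to\sigma)$; $\mathsf I:\sigma\to\sigma$; from $M:\sigma\to\tau$, $N:\sigma$ infer $MN:\tau$). $LCL$-formulas: $\alpha,\beta ::= M:\sigma\mid\neg\alpha\mid\alpha\Rightarrow\beta$ with $M:\sigma\in CL_\rightarrow$ ($\wedge$ defined classically). Axioms: (Ax1) $\mathsf S:(\sigma\to(\tau\to\rho))\to((\sigma\to\tau)\to(\sigma\to\rho))$; (Ax2) $\mathsf K:\sigma\to(\tau\to\sigma)$; (Ax3) $\mathsf I:\sigma\to\sigma$; (Ax4) $(M:\sigma\to\tau)\Rightarrow((N:\sigma)\Rightarrow(MN:\tau))$ when the three statements are in $CL_\rightarrow$; (Ax5) $M:\sigma\Rightarrow N:\sigma$ when $M=_{w,\eta}N$ and both are in $CL_\rightarrow$; (Ax6) $\alpha\Rightarrow(\beta\Rightarrow\alpha)$; (Ax7) $(\alpha\Rightarrow(\beta\Rightarrow\gamma))\Rightarrow((\alpha\Rightarrow\beta)\Rightarrow(\alpha\Rightarrow\gamma))$; (Ax8) $(\neg\alpha\Rightarrow\neg\beta)\Rightarrow((\neg\alpha\Rightarrow\beta)\Rightarrow\alpha)$; rule Modus Ponens. A set is consistent if some formula is not derivable from it; maximal consistent if consistent and for every $\alpha$, $\alpha\in T$ or $\neg\alpha\in T$. Semantics: given the tuple above (an applicative structure) and an environment $\rho:V\to D$, interpretation is $[\![x]\!]_\rho=\rho(x)$, $[\![\mathsf S]\!]_\rho=\mathbf s$, $[\![\mathsf K]\!]_\rho=\mathbf k$, $[\![\mathsf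 I]\!]_\rho=\mathbf i$, $[\![MN]\!]_\rho=[\![M]\!]_\rho\cdot[\![N]\!]_\rho$. Satisfaction: $\models M:\sigma$ iff $[\![M]\!]_\rho\in A^\sigma$; $\models\neg\alpha$ iff not $\models\alpha$; $\models\alpha\wedge\beta$ iff both; $\models\alpha\Rightarrow\beta$ iff not $\models\alpha$ or $\models\beta$. -}

module Defs where

open import Data.Nat using (ℕ)
open import Data.Maybe using (Maybe; just)
open import Data.Product using (Σ; _×_; _,_)
open import Data.Sum using (_⊎_)
open import Relation.Nullary using (¬_)
open import Relation.Binary.PropositionalEquality using (_≡_)
open import Level using (0ℓ) renaming (suc to lsuc)

Var : Set
Var = ℕ

Atom : Set
Atom = ℕ

data Term : Set where
  var : Var → Term
  S K I : Term
  _·_ : Term → Term → Term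

infixl 9 _·_

data Occurs (x : Var) : Term → Set where
  here : Occurs x (var x)
  left : ∀ {M N} → Occurs x M → Occurs x (M · N)
  right : ∀ {M N} → Occurs x N → Occurs x (M · N)

infix 4 _=wη_

data _=wη_ : Term → Term → Set where
  refl= : ∀ {M} → M =wη M
  S= : ∀ {M N L} → ((S · M) · N) · L =wη ((M · L) · (N · L))
  K= : ∀ {M N} → (K · M) · N =wη M
  I= : ∀ {M} → I · M =wη M
  sym= : ∀ {M N} → M =wη N → N =wη M
  trans= : ∀ {M N L} → M =wη N → N =wη L → M =wη L
  appL= : ∀ {M N P} → M =wη N → (M · P) =wη (N · P)
  appR= : ∀ {M N P} → M =wη N → (P · M) =wη (P · N)
  ext= : ∀ {M N x} → ¬ (Occurs x M) → ¬ (Occurs x N) →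
         (M · var x) =wη (N · var x) → M =wη N

data Type : Set where
  atom : Atom → Type
  _⟶_ : Type → Type → Type

infixr 7 _⟶_

-- A basis: a partial assignment of types to variables (so the declared
-- variables are automatically distinct).
Basis : Set
Basis = Var → Maybe Type

infix 4 _⊢_∶_

data _⊢_∶_ (Γ : Basis) : Term → Type → Set where
  tvar : ∀ {x σ} → Γ x ≡ just σ → Γ ⊢ var x ∶ σ
  tS : ∀ {σ ρ τ} → Γ ⊢ S ∶ (σ ⟶ (ρ ⟶ τ)) ⟶ ((σ ⟶ ρ) ⟶ (σ ⟶ τ))
  tK : ∀ {σ τ} → Γ ⊢ K ∶ σ ⟶ (τ ⟶ σ)
  tI : ∀ {σ} → Γ ⊢ I ∶ σ ⟶ σ
  tapp : ∀ {M N σ τ} → Γ ⊢ M ∶ σ ⟶ τ → Γ ⊢ N ∶ σ → Γ ⊢ M · N ∶ τ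

InCL→ : Term → Type → Set
InCL→ M σ = Σ Basis λ Γ → Γ ⊢ M ∶ σ

-- Raw LCL-formulas; well-formedness below restricts atoms to CL→
data Formula : Set where
  _∶_ : Term → Type → Formula
  ¬' : Formula → Formula
  _⇒_ : Formula → Formula → Formula

infix 6 _∶_
infixr 4 _⇒_

data WF : Formula → Set where
  wf-at : ∀ {M σ} → InCL→ M σ → WF (M ∶ σ)
  wf-neg : ∀ {α} → WF α → WF (¬' α)
  wf-imp : ∀ {α β} → WF α → WF β → WF (α ⇒ β)

FSet : Set₁
FSet = Formula → Set

infix 3 _⊢L_

data _⊢L_ (T : FSet) : Formula → Set where
  hyp : ∀ {α} → T α → T ⊢L α
  ax1 : ∀ {σ τ ρ} → T ⊢L (S ∶ (σ ⟶ (τ ⟶ ρ)) ⟶ ((σ ⟶ τ) ⟶ (σ ⟶ ρ)))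
  ax2 : ∀ {σ τ} → T ⊢L (K ∶ σ ⟶ (τ ⟶ σ))
  ax3 : ∀ {σ} → T ⊢L (I ∶ σ ⟶ σ)
  ax4 : ∀ {M N σ τ} → InCL→ M (σ ⟶ τ) → InCL→ N σ → InCL→ (M · N) τ →
        T ⊢L ((M ∶ σ ⟶ τ) ⇒ ((N ∶ σ) ⇒ (M · N ∶ τ)))
  ax5 : ∀ {M N σ} → M =wη N → InCL→ M σ → InCL→ N σ →
        T ⊢L ((M ∶ σ) ⇒ (N ∶ σ))
  ax6 : ∀ {α β} → WF α → WF β → T ⊢L (α ⇒ (β ⇒ α))
  ax7 : ∀ {α β γ} → WF α → WF β → WF γ →
        T ⊢L ((α ⇒ (β ⇒ γ)) ⇒ ((α ⇒ β) ⇒ (α ⇒ γ)))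
  ax8 : ∀ {α β} → WF α → WF β →
        T ⊢L ((¬' α ⇒ ¬' β) ⇒ ((¬' α ⇒ β) ⇒ α))
  mp : ∀ {α β} → T ⊢L (α ⇒ β) → T ⊢L α → T ⊢L β

IsLCLSet : FSet → Set
IsLCLSet T = ∀ α → T α → WF α

Consistent : FSet → Set
Consistent T = Σ Formula λ α → WF α × ¬ (T ⊢L α)

MaxConsistent : FSet → Set
MaxConsistent T = IsLCLSet T × Consistent T × (∀ α → WF α → T α ⊎ T (¬' α))

-- Applicative structures ⟨D, {A^σ}, ·, s, k, i⟩ (elements of D are given
-- by a carrier together with the structure's equality implicit in A/app)
record Structure : Set₁ where
  field
    D : Set
    A : Type → D → Set
    app : D → D → D
    s k i : D

module _ (𝓜 : Structure) where
  open Structure 𝓜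

  ⟦_⟧ : Term → (Var → D) → D
  ⟦ var x ⟧ ρ = ρ x
  ⟦ S ⟧ ρ = s
  ⟦ K ⟧ ρ = k
  ⟦ I ⟧ ρ = i
  ⟦ M · N ⟧ ρ = app (⟦ M ⟧ ρ) (⟦ N ⟧ ρ)

  _,_⊨_ : (Var → D) → Formula → Set
  _,_⊨_ ρ (M ∶ σ) = A σ (⟦ M ⟧ ρ)
  _,_⊨_ ρ (¬' α) = ¬ (_,_⊨_ ρ α)
  _,_⊨_ ρ (α ⇒ β) = ¬ (_,_⊨_ ρ α) ⊎ _,_⊨_ ρ β

-- The canonical model M_{T*}: D = CL/=wη, represented by terms M standing
-- for their classes [M]; [M]·[N] = [MN]; s,k,i = [S],[K],[I];
-- [N] ∈ A^σ  iff  [N] = [M] for some M with M:σ ∈ T*.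
canonical : FSet → Structure
canonical T = record
  { D = Term
  ; A = λ σ N → Σ Term λ M → (M =wη N) × T (M ∶ σ)
  ; app = _·_
  ; s = S ; k = K ; i = I }

ρ* : Var → Term
ρ* = var

-- Maximality and consistency make membership in T* commute with the connectives:
-- ¬'α ∈ T* iff α ∉ T*, and α ⇒ β ∈ T* iff α ∉ T* or β ∈ T*. These are exactly the
-- satisfaction clauses, so by induction on α everything reduces to the atomic case.
-- There a term evaluates to itself under ρ*, and [M] ∈ A^σ means M' : σ ∈ T* for
-- some M' =wη M, which transfers to M : σ by Ax5.
module Submission where

open import Defs
open import Data.Product using (_×_; _,_; proj₁; proj₂)
open import Data.Sum using (_⊎_; inj₁; inj₂)
open import Data.Sum.Function.Propositional using (_⊎-cong_)
open import Data.Empty using (⊥-elim)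
open import Function.Bundles using (_⇔_; mk⇔; Equivalence)
open import Function.Construct.Symmetry using (⇔-sym)
open import Function.Related.TypeIsomorphisms using (¬-cong-⇔)
open import Function.Related.Propositional using (module EquationalReasoning)
open import Relation.Nullary using (¬_)
open import Relation.Binary.PropositionalEquality using (_≡_; refl; cong₂; subst; sym)

module Derivations {T : FSet} where

  ⇒-intro-const : ∀ {α β} → WF α → WF β → T ⊢L β → T ⊢L (α ⇒ β)
  ⇒-intro-const wα wβ ⊢β = mp (ax6 wβ wα) ⊢β

  mp-under : ∀ {α β γ} → WF α → WF β → WF γ →
             T ⊢L (α ⇒ (β ⇒ γ)) → T ⊢L (α ⇒ β) → T ⊢L (α ⇒ γ)
  mp-under wα wβ wγ ⊢α⇒β⇒γ ⊢α⇒β = mp (mp (ax7 wα wβ wγ) ⊢α⇒β⇒γ) ⊢α⇒β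

  explosion : ∀ {α β} → WF α → WF β → T ⊢L α → T ⊢L ¬' α → T ⊢L β
  explosion wα wβ ⊢α ⊢¬α =
    mp (mp (ax8 wβ wα) (⇒-intro-const (wf-neg wβ) (wf-neg wα) ⊢¬α))
       (⇒-intro-const (wf-neg wβ) wα ⊢α)

  -- Under the hypothesis α, instantiate Ax8 with ¬β ⇒ ¬α (from ¬α) and ¬β ⇒ α (Ax6).
  ¬⇒-intro : ∀ {α β} → WF α → WF β → T ⊢L ¬' α → T ⊢L (α ⇒ β)
  ¬⇒-intro {α} {β} wα wβ ⊢¬α =
    mp-under wα (wf-imp (wf-neg wβ) wα) wβ
      (mp-under wα ¬β⇒¬α (wf-imp (wf-imp (wf-neg wβ) wα) wβ)
        (⇒-intro-const wα (wf-imp ¬β⇒¬α (wf-imp (wf-imp (wf-neg wβ) wα) wβ)) (ax8 wβ wα))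
        (⇒-intro-const wα ¬β⇒¬α (⇒-intro-const (wf-neg wβ) (wf-neg wα) ⊢¬α)))
      (ax6 wα (wf-neg wβ))
    where
    ¬β⇒¬α : WF (¬' β ⇒ ¬' α)
    ¬β⇒¬α = wf-imp (wf-neg wβ) (wf-neg wα)

module MaxConsistentSet {T : FSet} (maxCons : MaxConsistent T) where
  open Derivations {T}

  private
    lcl : IsLCLSet T
    lcl = proj₁ maxCons

    consistent : Consistent T
    consistent = proj₁ (proj₂ maxCons)

    complete : ∀ α → WF α → T α ⊎ T (¬' α)
    complete = proj₂ (proj₂ maxCons)

  ¬-provable-both : ∀ {α} → WF α → T ⊢L α → ¬ (T ⊢L ¬' α)
  ¬-provable-both wα ⊢α ⊢¬α with consistent
  ... | φ , wφ , ⊬φ = ⊬φ (explosion wα wφ ⊢α ⊢¬α)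

  deductivelyClosed : ∀ {α} → WF α → T ⊢L α → T α
  deductivelyClosed {α} wα ⊢α with complete α wα
  ... | inj₁ α∈T = α∈T
  ... | inj₂ ¬α∈T = ⊥-elim (¬-provable-both wα ⊢α (hyp ¬α∈T))

  ∈-¬' : ∀ {α} → WF α → T (¬' α) ⇔ (¬ T α)
  ∈-¬' {α} wα = mk⇔ (λ ¬α∈T α∈T → ¬-provable-both wα (hyp α∈T) (hyp ¬α∈T)) from
    where
    from : ¬ T α → T (¬' α)
    from α∉T with complete α wα
    ... | inj₁ α∈T = ⊥-elim (α∉T α∈T)
    ... | inj₂ ¬α∈T = ¬α∈T

  ∈-⇒ : ∀ {α β} → WF α → WF β → T (α ⇒ β) ⇔ (¬ T α ⊎ T β)
  ∈-⇒ {α} {β} wα wβ = mk⇔ to from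
    where
    to : T (α ⇒ β) → ¬ T α ⊎ T β
    to α⇒β∈T with complete α wα
    ... | inj₁ α∈T = inj₂ (deductivelyClosed wβ (mp (hyp α⇒β∈T) (hyp α∈T)))
    ... | inj₂ ¬α∈T = inj₁ (Equivalence.to (∈-¬' wα) ¬α∈T)
    from : ¬ T α ⊎ T β → T (α ⇒ β)
    from (inj₁ α∉T) = deductivelyClosed (wf-imp wα wβ)
      (¬⇒-intro wα wβ (hyp (Equivalence.from (∈-¬' wα) α∉T)))
    from (inj₂ β∈T) = deductivelyClosed (wf-imp wα wβ) (⇒-intro-const wα wβ (hyp β∈T))

  ∈-∶-resp-=wη : ∀ {M N σ} → InCL→ N σ → M =wη N → T (M ∶ σ) → T (N ∶ σ)
  ∈-∶-resp-=wη {M} N∶σ M=N M∶σ∈T with lcl (M ∶ _) M∶σ∈T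
  ... | wf-at M∶σ = deductivelyClosed (wf-at N∶σ) (mp (ax5 M=N M∶σ N∶σ) (hyp M∶σ∈T))

⟦⟧-canonical-ρ* : (T : FSet) (M : Term) → ⟦ canonical T ⟧ M ρ* ≡ M
⟦⟧-canonical-ρ* T (var x) = refl
⟦⟧-canonical-ρ* T S = refl
⟦⟧-canonical-ρ* T K = refl
⟦⟧-canonical-ρ* T I = refl
⟦⟧-canonical-ρ* T (M · N) = cong₂ _·_ (⟦⟧-canonical-ρ* T M) (⟦⟧-canonical-ρ* T N)

module TruthLemma {T : FSet} (maxCons : MaxConsistent T) where
  open MaxConsistentSet maxCons
  open EquationalReasoning

  truth : ∀ {α} → WF α → (canonical T , ρ* ⊨ α) ⇔ T α
  truth {M ∶ σ} (wf-at M∶σ) = mk⇔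
    (λ { (M' , M'=⟦M⟧ , M'∶σ∈T) →
         ∈-∶-resp-=wη M∶σ (subst (M' =wη_) (⟦⟧-canonical-ρ* T M) M'=⟦M⟧) M'∶σ∈T })
    (λ M∶σ∈T → M , subst (M =wη_) (sym (⟦⟧-canonical-ρ* T M)) refl= , M∶σ∈T)
  truth {¬' α} (wf-neg wα) = begin
    (¬ canonical T , ρ* ⊨ α)  ∼⟨ ¬-cong-⇔ (truth wα) ⟩
    (¬ T α)                   ∼⟨ ⇔-sym (∈-¬' wα) ⟩
    T (¬' α)                  ∎
  truth {α ⇒ β} (wf-imp wα wβ) = begin
    ((¬ canonical T , ρ* ⊨ α) ⊎ canonical T , ρ* ⊨ β)  ∼⟨ ¬-cong-⇔ (truth wα) ⊎-cong truth wβ ⟩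
    ((¬ T α) ⊎ T β)                                    ∼⟨ ⇔-sym (∈-⇒ wα wβ) ⟩
    T (α ⇒ β)                                          ∎

mainTheorem11 : (T : FSet) → MaxConsistent T → (α : Formula) → WF α →
    ((canonical T , ρ* ⊨ α → T α) × (T α → canonical T , ρ* ⊨ α))
mainTheorem11 T maxCons α wα = Equivalence.to truthα , Equivalence.from truthα
  where
  truthα : (canonical T , ρ* ⊨ α) ⇔ T α
  truthα = TruthLemma.truth maxCons wα
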